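{- Let $q\geq 3$, $d>0$ and $c>1$. Then $$\chi(T_q,[d,cd])\leq (q-1)^{\lfloor \frac{cd}{2}+1\rfloor}\left(\lfloor cd\rfloor+1\right).$$
   Context: $T_q$ is the infinite $q$-regular tree, viewed as a metric space on its vertex set where each edge has length $1$ (combinatorial graph distance). $\chi(T_q,[d,cd])$ denotes the minimal number of colors needed to color the vertices of $T_q$ so that any two vertices whose distance lies in the interval $[d,cd]$ receive different colors. -}

module Defs where

open import Data.Nat using (ℕ; zero; suc; _<_)
open import Data.Fin using (Fin)
open import Data.List using (List; []; _∷_)
open import Data.Product using (Σ; ∃; _×_; proj₁)
open import Data.Sum using (_⊎_)
open import Relation.Binary.PropositionalEquality using (_≡_)
open import Relation.Nullary using (¬_)

-- The infinite q-regular tree T_q, realised as the Cayley graph of the free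
-- product of q copies of ℤ/2: vertices are reduced words over the alphabet
-- Fin q (no two consecutive letters equal). The empty word has the q
-- neighbours  i ∷ [] ; a word  i ∷ w  has the parent  w  and the q-1
-- children  j ∷ i ∷ w  with j ≠ i. So every vertex has degree q.

data Reduced {q : ℕ} : List (Fin q) → Set where
  nil  : Reduced []
  one  : (i : Fin q) → Reduced (i ∷ [])
  cons : {i j : Fin q} {w : List (Fin q)} →
         ¬ (i ≡ j) → Reduced (j ∷ w) → Reduced (i ∷ j ∷ w)

T : ℕ → Set
T q = Σ (List (Fin q)) Reduced

Adj : {q : ℕ} → T q → T q → Set
Adj {q} u v =
  (∃ λ (i : Fin q) → proj₁ v ≡ i ∷ proj₁ u) ⊎
  (∃ λ (i : Fin q) → proj₁ u ≡ i ∷ proj₁ v)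

data Walk {q : ℕ} : T q → T q → ℕ → Set where
  here : (u : T q) → Walk u u zero
  step : {u v w : T q} {k : ℕ} → Adj u v → Walk v w k → Walk u w (suc k)

Dist : {q : ℕ} → T q → T q → ℕ → Set
Dist u v k = Walk u v k × (∀ m → m < k → ¬ Walk u v m)

module Submission where

-- Colouring T_q so that vertices at distance in [a, b] get distinct colours,
-- with (q-1)^(⌊b/2⌋+1) · (b+1) colours.  Write p = q - 1 and m = ⌊b/2⌋.
--
-- A vertex is a reduced word u; its first letters describe the path from u
-- towards the root.  The colour of u is the pair
--   ( a code of the first m letters of u ,  |u| mod (b+1) ).
-- Any walk of length k from u to v exhibits a "fork": u = x ++ c and
-- v = y ++ c with |x| + |y| ≤ k (climb from u to the ancestor c, then
-- descend to v).  If k ≤ b and u, v have the same colour, then equal depths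
-- mod (b+1) force |x| = |y| (as |x|, |y| ≤ b), hence |x| ≤ m, and the equal
-- m-prefixes force x = y, so u = v: their distance is 0, not ≥ a ≥ 1.

open import Defs
open import Data.Nat using (ℕ; _≤_; _+_; _*_; _∸_; _^_; _/_)
open import Data.Fin using (Fin)
open import Data.Product using (∃)
open import Relation.Binary.PropositionalEquality using (_≢_)

open import Data.Nat using (zero; suc; _<_; _%_; z≤n; s≤s; NonZero; >-nonZero)
open import Data.Nat.Properties
open import Data.Nat.DivMod using (m≡m%n+[m/n]*n; m%n<n; m<n⇒m%n≡m; m*n/n≡m; /-monoˡ-≤)
open import Data.Nat.Divisibility using (_∣_; divides; n∣m⇒m%n≡0)
open import Data.Fin using (fromℕ<; inject≤; combine; punchOut)
open import Data.Fin.Properties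
  using (fromℕ<-injective; inject≤-injective; combine-injective; punchOut-injective)
open import Data.List using (List; []; _∷_; _++_; [_]; length; take)
open import Data.List.Properties using (∷-injective; length-++; ++-assoc)
open import Data.Product using (_,_; proj₁; proj₂)
open import Data.Sum using (inj₁; inj₂)
open import Function using (_∘_)
open import Relation.Binary.PropositionalEquality
  using (_≡_; refl; sym; trans; cong; cong₂; subst; module ≡-Reasoning)

Reduced-irrelevant : ∀ {q} {w : List (Fin q)} (r r′ : Reduced w) → r ≡ r′
Reduced-irrelevant nil         nil           = refl
Reduced-irrelevant (one i)     (one .i)      = refl
Reduced-irrelevant (cons _ r) (cons _ r′)
  rewrite Reduced-irrelevant r r′ = refl

vertex-≡ : ∀ {q} {u v : T q} → proj₁ u ≡ proj₁ v → u ≡ v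
vertex-≡ {u = w , r} {v = .w , r′} refl = cong (w ,_) (Reduced-irrelevant r r′)

record Fork {A : Set} (u v : List A) (k : ℕ) : Set where
  constructor fork
  field
    up down base : List A
    u-split      : u ≡ up ++ base
    v-split      : v ≡ down ++ base
    short        : length up + length down ≤ k

fork-from-child : ∀ {A : Set} {i : A} {w v k} → Fork w v k → Fork (i ∷ w) v (suc k)
fork-from-child {i = i} (fork x y c refl v-split short) =
  fork (i ∷ x) y c refl v-split (s≤s short)

-- A walk from u whose first step goes down to the child i ∷ u: either that
-- child is the base, and then u becomes the base with i added to the
-- downward branch, or the child's upward branch passes through u.
fork-from-parent : ∀ {A : Set} {i : A} {u v k} → Fork (i ∷ u) v k → Fork u v (suc k)
fork-from-parent {i = i} {u} {k = k} (fork [] y .(i ∷ u) refl refl short) =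
  fork [] (y ++ [ i ]) u refl (sym (++-assoc y [ i ] u)) |y++i|≤1+k
  where
  |y++i|≤1+k : length (y ++ [ i ]) ≤ suc k
  |y++i|≤1+k = subst (_≤ suc k) (sym (trans (length-++ y) (+-comm (length y) 1))) (s≤s short)
fork-from-parent (fork (_ ∷ x) y c refl v-split short) =
  fork x y c refl v-split (≤-trans (n≤1+n _) (m≤n⇒m≤1+n short))

walk⇒fork : ∀ {q} {u v : T q} {k} → Walk u v k → Fork (proj₁ u) (proj₁ v) k
walk⇒fork (here u)                   = fork [] [] (proj₁ u) refl refl z≤n
walk⇒fork (step (inj₁ (i , refl)) w) = fork-from-parent (walk⇒fork w)
walk⇒fork (step (inj₂ (i , refl)) w) = fork-from-child (walk⇒fork w)

-- Congruent numbers less than N apart are equal: their difference is a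
-- multiple of N below N.
close-congruent⇒≡ : ∀ {N a b} .{{_ : NonZero N}} →
                    a ≤ b → b < a + N → a % N ≡ b % N → a ≡ b
close-congruent⇒≡ {N} {a} {b} a≤b b<a+N ≡mod = ≤-antisym a≤b (m∸n≡0⇒m≤n gap≡0)
  where
  open ≡-Reasoning
  N∣gap : N ∣ b ∸ a
  N∣gap = divides (b / N ∸ a / N) (begin
    b ∸ a                                     ≡⟨ cong₂ _∸_ (m≡m%n+[m/n]*n b N) (m≡m%n+[m/n]*n a N) ⟩
    (b % N + b / N * N) ∸ (a % N + a / N * N) ≡⟨ cong (λ r → (r + b / N * N) ∸ (a % N + a / N * N)) (sym ≡mod) ⟩
    (a % N + b / N * N) ∸ (a % N + a / N * N) ≡⟨ [m+n]∸[m+o]≡n∸o (a % N) _ _ ⟩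
    b / N * N ∸ a / N * N                     ≡⟨ sym (*-distribʳ-∸ N (b / N) (a / N)) ⟩
    (b / N ∸ a / N) * N                       ∎)
  gap≡0 : b ∸ a ≡ 0
  gap≡0 = trans (sym (m<n⇒m%n≡m (m<n+o⇒m∸n<o b a b<a+N))) (n∣m⇒m%n≡0 (b ∸ a) N N∣gap)

residue-window-≤ : ∀ {N} .{{_ : NonZero N}} {s t} c →
                   s ≤ t → t < N → (s + c) % N ≡ (t + c) % N → s ≡ t
residue-window-≤ {N} {s} {t} c s≤t t<N ≡mod =
  +-cancelʳ-≡ c s t (close-congruent⇒≡ (+-monoˡ-≤ c s≤t) t+c<s+c+N ≡mod)
  where
  open ≤-Reasoning
  t+c<s+c+N : t + c < s + c + N
  t+c<s+c+N = begin-strict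
    t + c     <⟨ +-monoˡ-< c t<N ⟩
    N + c     ≡⟨ +-comm N c ⟩
    c + N     ≤⟨ +-monoˡ-≤ N (m≤n+m c s) ⟩
    s + c + N ∎

residue-window : ∀ {N} .{{_ : NonZero N}} s t c →
                 s < N → t < N → (s + c) % N ≡ (t + c) % N → s ≡ t
residue-window s t c s<N t<N ≡mod with ≤-total s t
... | inj₁ s≤t = residue-window-≤ c s≤t t<N ≡mod
... | inj₂ t≤s = sym (residue-window-≤ c t≤s s<N (sym ≡mod))

module PrefixCode (p : ℕ) (2≤p : 2 ≤ p) where

  instance
    p-nonZero : NonZero p
    p-nonZero = >-nonZero (≤-trans (s≤s z≤n) 2≤p)

  -- number of codes for the first n + 1 letters of a word: (p + 1) · pⁿ
  size : ℕ → ℕ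
  size zero    = suc p
  size (suc n) = p * size n

  q≤size : ∀ n → suc p ≤ size n
  q≤size zero    = ≤-refl
  q≤size (suc n) = ≤-trans (q≤size n) (m≤n*m (size n) p)

  -- (p + 1) · pⁿ ≤ p^(n+2), since p + 1 ≤ p² for p ≥ 2.
  size≤power : ∀ n → size n ≤ p ^ (suc n + 1)
  size≤power zero = begin
    suc p      ≤⟨ +-monoˡ-≤ p (≤-trans (s≤s z≤n) 2≤p) ⟩
    p + p      ≡⟨ cong (p +_) (sym (+-identityʳ p)) ⟩
    2 * p      ≤⟨ *-monoˡ-≤ p 2≤p ⟩
    p * p      ≡⟨ cong (p *_) (sym (*-identityʳ p)) ⟩
    p ^ 2      ∎
    where open ≤-Reasoning
  size≤power (suc n) = *-monoʳ-≤ p (size≤power n)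

  -- Code of the first n + 1 letters of a nonempty reduced word  i ∷ w :
  -- each letter but the last one of the prefix is recorded relative to its
  -- successor (p choices, as they differ); the last one absolutely.
  code : ∀ n (i : Fin (suc p)) w → Reduced (i ∷ w) → Fin (size n)
  code zero    i w       _            = i
  code (suc n) i []      _            = inject≤ i (q≤size (suc n))
  code (suc n) i (j ∷ w) (cons i≢j r) = combine (punchOut (i≢j ∘ sym)) (code n j w r)

  -- Codes separate the (n+1)-prefixes of equally long reduced words; the
  -- length hypothesis excludes comparing a word that ends inside the prefix
  -- with one that does not.
  code-injective : ∀ n {i i′ w w′} (r : Reduced (i ∷ w)) (r′ : Reduced (i′ ∷ w′)) →
                   length w ≡ length w′ → code n i w r ≡ code n i′ w′ r′ →
                   take (suc n) (i ∷ w) ≡ take (suc n) (i′ ∷ w′)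
  code-injective zero    r r′ _ refl = refl
  code-injective (suc n) {w = []} {[]} r r′ _ ≡code =
    cong (_∷ []) (inject≤-injective _ _ _ _ ≡code)
  code-injective (suc n) {i} {i′} {j ∷ w} {j′ ∷ w′} (cons i≢j r) (cons i′≢j′ r′) ≡len ≡code
    with combine-injective _ _ _ _ ≡code
  ... | ≡rel , ≡rest with code-injective n r r′ (suc-injective ≡len) ≡rest
  ... | ≡tail with ∷-injective ≡tail
  ... | refl , _ = cong₂ _∷_ (punchOut-injective (i≢j ∘ sym) (i′≢j′ ∘ sym) ≡rel) ≡tail

  -- Code of the first m letters of a reduced word, in p^(m+1) colours;
  -- when m = 0 or the word is empty there is only one prefix, coded by 0.
  prefixCode : ∀ m (w : List (Fin (suc p))) → Reduced w → Fin (p ^ (m + 1))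
  prefixCode (suc n) (i ∷ w) r = inject≤ (code n i w r) (size≤power n)
  prefixCode m       _       _ = fromℕ< (m^n>0 p (m + 1))

  prefixCode-injective : ∀ m {w w′} (r : Reduced w) (r′ : Reduced w′) →
                         length w ≡ length w′ → prefixCode m w r ≡ prefixCode m w′ r′ →
                         take m w ≡ take m w′
  prefixCode-injective zero    {w}     {w′}     r r′ _ _ = refl
  prefixCode-injective (suc n) {[]}    {[]}     r r′ _ _ = refl
  prefixCode-injective (suc n) {i ∷ w} {i′ ∷ w′} r r′ ≡len ≡code =
    code-injective n r r′ (suc-injective ≡len) (inject≤-injective _ _ _ _ ≡code)

half-bound : ∀ s b → s + s ≤ b → s ≤ b / 2
half-bound s b s+s≤b = subst (_≤ b / 2) (m*n/n≡m s 2) (/-monoˡ-≤ 2 (subst (_≤ b) s+s≡s*2 s+s≤b))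
  where
  s+s≡s*2 : s + s ≡ s * 2
  s+s≡s*2 = sym (trans (*-suc s 1) (cong (s +_) (*-identityʳ s)))

fork-balanced : ∀ {A : Set} {u v : List A} {k N} .{{_ : NonZero N}} (F : Fork u v k) →
                k < N → length u % N ≡ length v % N →
                length (Fork.up F) ≡ length (Fork.down F)
fork-balanced {N = N} (fork x y c refl refl short) k<N ≡mod =
  residue-window (length x) (length y) (length c) |x|<N |y|<N
    (trans (cong (_% N) (sym (length-++ x))) (trans ≡mod (cong (_% N) (length-++ y))))
  where
  |x|<N : length x < N
  |x|<N = ≤-<-trans (m+n≤o⇒m≤o (length x) short) k<N
  |y|<N : length y < N
  |y|<N = ≤-<-trans (m+n≤o⇒n≤o (length x) short) k<N

balanced-fork-depth : ∀ {A : Set} {u v : List A} {k} (F : Fork u v k) →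
                      length (Fork.up F) ≡ length (Fork.down F) → length u ≡ length v
balanced-fork-depth (fork x y c refl refl _) |x|≡|y| = begin
  length (x ++ c)       ≡⟨ length-++ x ⟩
  length x + length c   ≡⟨ cong (_+ length c) |x|≡|y| ⟩
  length y + length c   ≡⟨ sym (length-++ y) ⟩
  length (y ++ c)       ∎
  where open ≡-Reasoning

take-++-cancelʳ : ∀ {A : Set} m (x y c : List A) → length x ≡ length y → length x ≤ m →
                  take m (x ++ c) ≡ take m (y ++ c) → x ≡ y
take-++-cancelʳ m       []      []      c _     _       _   = refl
take-++-cancelʳ (suc m) (a ∷ x) (b ∷ y) c ≡len (s≤s |x|≤m) ≡take with ∷-injective ≡take
... | refl , ≡rest = cong (a ∷_) (take-++-cancelʳ m x y c (suc-injective ≡len) |x|≤m ≡rest)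

balanced-fork-collapse : ∀ {A : Set} {u v : List A} {k} m (F : Fork u v k) →
                         length (Fork.up F) ≡ length (Fork.down F) → length (Fork.up F) ≤ m →
                         take m u ≡ take m v → u ≡ v
balanced-fork-collapse m (fork x y c refl refl _) |x|≡|y| |x|≤m ≡take =
  cong (_++ c) (take-++-cancelʳ m x y c |x|≡|y| |x|≤m ≡take)

mainTheorem14 : (q a b : ℕ) → 3 ≤ q → 1 ≤ a →
    ∃ λ (f : T q → Fin ((q ∸ 1) ^ (b / 2 + 1) * (b + 1))) →
    ∀ (u v : T q) (k : ℕ) → Dist u v k → a ≤ k → k ≤ b → f u ≢ f v
mainTheorem14 (suc p) a b (s≤s 2≤p) 1≤a = colour , separated
  where
  open PrefixCode p 2≤p

  instance
    b+1-nonZero : NonZero (b + 1)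
    b+1-nonZero = >-nonZero (m≤n+m 1 b)

  colour : T (suc p) → Fin (p ^ (b / 2 + 1) * (b + 1))
  colour (w , r) = combine (prefixCode (b / 2) w r) (fromℕ< (m%n<n (length w) (b + 1)))

  separated : ∀ (u v : T (suc p)) (k : ℕ) → Dist u v k → a ≤ k → k ≤ b → colour u ≢ colour v
  separated u@(w , r) (w′ , r′) k (walk , minimal) a≤k k≤b ≡colour =
    minimal 0 (≤-trans 1≤a a≤k) (subst (λ v → Walk u v 0) (vertex-≡ w≡w′) (here u))
    where
    F : Fork w w′ k
    F = walk⇒fork walk
    same-prefix : prefixCode (b / 2) w r ≡ prefixCode (b / 2) w′ r′
    same-prefix = proj₁ (combine-injective (prefixCode (b / 2) w r) _ _ _ ≡colour)
    same-depth : length w % (b + 1) ≡ length w′ % (b + 1)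
    same-depth = fromℕ<-injective _ _ _ _ (proj₂ (combine-injective (prefixCode (b / 2) w r) _ _ _ ≡colour))
    balanced : length (Fork.up F) ≡ length (Fork.down F)
    balanced = fork-balanced F (subst (k <_) (+-comm 1 b) (s≤s k≤b)) same-depth
    |up|≤b/2 : length (Fork.up F) ≤ b / 2
    |up|≤b/2 = half-bound _ b (≤-trans (≤-reflexive (cong (length (Fork.up F) +_) balanced))
                                       (≤-trans (Fork.short F) k≤b))
    w≡w′ : w ≡ w′
    w≡w′ = balanced-fork-collapse (b / 2) F balanced |up|≤b/2
             (prefixCode-injective (b / 2) r r′ (balanced-fork-depth F balanced) same-prefix)
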